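{- Let $\mathcal{S}$ be an intersection-closed biset-family on $V$ and $F$ a set of directed edges that covers $\mathcal{S}$. Let $\mathcal{U}\subseteq\mathcal{S}$ be a subfamily of pairwise disjoint bisets such that every edge in $F$ has its tail in the inner part of some $\hat U\in\mathcal{U}$, and such that for every $\hat U\in\mathcal{U}$, $\delta_F(\hat U)=\{e_U\}$ for a single edge $e_U$. Let $J\subseteq F$ be a cover of $\mathcal{S}[\mathcal{U}]$ and let $\hat C$ be a core of $\mathcal{S}^J$. Then: (i) if $\hat U\in\mathcal{U}$ and $\hat C$ intersect, then $\delta_J(\hat C\cap\hat U)=\{e_U\}$; thus $\hat U$ intersects no core of $\mathcal{S}^J$ distinct from $\hat C$; (ii) $\delta_F(\hat B_C)=\emptyset$, where $\hat B_C$ is the union of $\hat C$ and the bisets in $\mathcal{U}$ intersecting $\hat C$; thus $\hat B_C\notin\mathcal{S}$.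
   Context: A biset on $V$ is a pair $\hat S=(S,S^+)$ with $S\subseteq S^+\subseteq V$ ($S$ its inner part), proper if $S\ne\emptyset\ne V\setminus S^+$; all biset-families consist of proper bisets. $\hat X,\hat Y$ intersect if $X\cap Y\ne\emptyset$, and are disjoint otherwise; $\hat X\cap\hat Y=(X\cap Y,X^+\cap Y^+)$, $\hat X\cup\hat Y=(X\cup Y,X^+\cup Y^+)$ (unions of several bisets componentwise). $\mathcal{S}$ is intersection-closed if $\hat X\cap\hat Y\in\mathcal{S}$ for all intersecting $\hat X,\hat Y\in\mathcal{S}$. Containment: $\hat X\subseteq\hat Y$ if $X\subset Y$, or $X=Y$ and $X^+\subseteq Y^+$. $\mathcal{S}[\mathcal{U}]=\{\hat S\in\mathcal{S}:\hat S\subseteq\hat U\text{ for some }\hat U\in\mathcal{U}\}$. A core of a family is a member containing no other member. A directed edge $uv$ covers $\hat S$ if $u\in S$, $v\in V\setminus S^+$; $\delta_J(\hat S)$ is the set of edges of $J$ covering $\hat S$; $\mathcal{S}^J$ is the set of members of $\mathcal{S}$ not covered by $J$. -}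

module Defs where

open import Data.Nat using (ℕ)
open import Data.Fin using (Fin)
open import Data.Fin.Subset using (Subset; _∈_; _∉_; _⊆_; _⊂_; _∩_; _∪_; Nonempty)
open import Data.Product using (Σ; ∃; _×_; _,_; proj₁; proj₂)
open import Data.Sum using (_⊎_)
open import Data.Empty using (⊥)
open import Relation.Nullary using (¬_)
open import Relation.Binary.PropositionalEquality using (_≡_; _≢_)
open import Function.Bundles using (_⇔_)

-- The ground set V is Fin n.
-- A (candidate) biset is a pair (S , S⁺) of subsets of V; the condition
-- S ⊆ S⁺ is recorded separately by IsBiset.
Biset : ℕ → Set
Biset n = Subset n × Subset n

module _ {n : ℕ} where

  inner : Biset n → Subset n
  inner = proj₁

  outer : Biset n → Subset n
  outer = proj₂

  IsBiset : Biset n → Set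
  IsBiset B = inner B ⊆ outer B

  Proper : Biset n → Set
  Proper B = Nonempty (inner B) × (∃ λ v → v ∉ outer B)

  Family : Set₁
  Family = Biset n → Set

  IsBisetFamily : Family → Set
  IsBisetFamily 𝒮 = ∀ B → 𝒮 B → IsBiset B × Proper B

  Intersect : Biset n → Biset n → Set
  Intersect X Y = Nonempty (inner X ∩ inner Y)

  Disjoint : Biset n → Biset n → Set
  Disjoint X Y = ¬ Intersect X Y

  _∩ᵇ_ : Biset n → Biset n → Biset n
  X ∩ᵇ Y = (inner X ∩ inner Y , outer X ∩ outer Y)

  _∪ᵇ_ : Biset n → Biset n → Biset n
  X ∪ᵇ Y = (inner X ∪ inner Y , outer X ∪ outer Y)

  IntersectionClosed : Family → Set
  IntersectionClosed 𝒮 = ∀ X Y → 𝒮 X → 𝒮 Y → Intersect X Y → 𝒮 (X ∩ᵇ Y)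

  _⊆ᵇ_ : Biset n → Biset n → Set
  X ⊆ᵇ Y = (inner X ⊂ inner Y) ⊎ (inner X ≡ inner Y × outer X ⊆ outer Y)

  restrictTo : Family → Family → Family
  restrictTo 𝒮 𝒰 B = 𝒮 B × ∃ λ U → 𝒰 U × B ⊆ᵇ U

  IsCore : Family → Biset n → Set
  IsCore 𝒮 C = 𝒮 C × (∀ B → 𝒮 B → B ⊆ᵇ C → B ≡ C)

  Edge : Set
  Edge = Fin n × Fin n

  EdgeSet : Set₁
  EdgeSet = Edge → Set

  tail : Edge → Fin n
  tail = proj₁

  head : Edge → Fin n
  head = proj₂

  CoversEdge : Edge → Biset n → Set
  CoversEdge e B = tail e ∈ inner B × head e ∉ outer B

  δ : EdgeSet → Biset n → EdgeSet
  δ J B e = J e × CoversEdge e B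

  CoversFamily : EdgeSet → Family → Set
  CoversFamily J 𝒮 = ∀ B → 𝒮 B → ∃ λ e → δ J B e

  _⊆ᵉ_ : EdgeSet → EdgeSet → Set
  J ⊆ᵉ F = ∀ e → J e → F e

  δIsSingleton : EdgeSet → Biset n → Edge → Set
  δIsSingleton J B e = ∀ e' → δ J B e' ⇔ (e' ≡ e)

  δIsEmpty : EdgeSet → Biset n → Set
  δIsEmpty J B = ∀ e → ¬ δ J B e

  uncovered : Family → EdgeSet → Family
  uncovered 𝒮 J B = 𝒮 B × ¬ (∃ λ e → δ J B e)

  IsUnionWithIntersecting : Family → Biset n → Biset n → Set
  IsUnionWithIntersecting 𝒰 C B =
    (∀ v → (v ∈ inner B) ⇔ (v ∈ inner C ⊎ ∃ λ U → 𝒰 U × Intersect U C × v ∈ inner U)) ×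
    (∀ v → (v ∈ outer B) ⇔ (v ∈ outer C ⊎ ∃ λ U → 𝒰 U × Intersect U C × v ∈ outer U))

-- A J-edge covering C ∩ U, where C is not covered by J, must leave C through U:
-- its head lies in C⁺ and it covers U. Hence it is the unique F-edge e_U of U,
-- which therefore belongs to J, covers C ∩ U and has its head in C⁺. Part (i)
-- follows, and two cores met by U share the tail of e_U, so they intersect;
-- their intersection is again in 𝒮^J and contained in both, so they coincide.
-- For (ii), an F-edge covering B̂_C has its tail in some Û ∈ 𝒰 meeting Ĉ, so it
-- covers Û and is e_U, whose head lies in C⁺ ⊆ B⁺.
module Submission where

open import Defs
open import Data.Nat using (ℕ)
open import Data.Fin.Subset using (Subset; _∈_; _⊆_; _⊂_)
open import Data.Fin.Subset.Properties
  using (_∈?_; _⊂?_; ⊆-antisym; p∩q⊆p; p∩q⊆q; x∈p∩q⁺; x∈p∩q⁻)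
open import Data.Product using (∃; _×_; _,_; proj₁; proj₂)
open import Data.Sum using (_⊎_; inj₁; inj₂; [_,_])
open import Function.Bundles using (mk⇔; Equivalence)
open import Relation.Nullary using (¬_; yes; no; contradiction)
open import Relation.Nullary.Decidable using (decidable-stable)
open import Relation.Binary.PropositionalEquality using (_≡_; _≢_; refl; sym; trans)

module _ {n : ℕ} where

  ⊆⇒⊂⊎≡ : {p q : Subset n} → p ⊆ q → p ⊂ q ⊎ p ≡ q
  ⊆⇒⊂⊎≡ {p} {q} p⊆q with p ⊂? q
  ... | yes p⊂q = inj₁ p⊂q
  ... | no p⊄q = inj₂ (⊆-antisym p⊆q λ {x} x∈q →
    decidable-stable (x ∈? p) λ x∉p → p⊄q (p⊆q , x , x∈q , x∉p))

  ⊆×⊆⇒⊆ᵇ : {X Y : Biset n} → inner X ⊆ inner Y → outer X ⊆ outer Y → X ⊆ᵇ Y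
  ⊆×⊆⇒⊆ᵇ X⊆Y X⁺⊆Y⁺ with ⊆⇒⊂⊎≡ X⊆Y
  ... | inj₁ X⊂Y = inj₁ X⊂Y
  ... | inj₂ X≡Y = inj₂ (X≡Y , X⁺⊆Y⁺)

  ∩ᵇ-⊆ᵇˡ : (X Y : Biset n) → (X ∩ᵇ Y) ⊆ᵇ X
  ∩ᵇ-⊆ᵇˡ X Y = ⊆×⊆⇒⊆ᵇ (p∩q⊆p (inner X) (inner Y)) (p∩q⊆p (outer X) (outer Y))

  ∩ᵇ-⊆ᵇʳ : (X Y : Biset n) → (X ∩ᵇ Y) ⊆ᵇ Y
  ∩ᵇ-⊆ᵇʳ X Y = ⊆×⊆⇒⊆ᵇ (p∩q⊆q (inner X) (inner Y)) (p∩q⊆q (outer X) (outer Y))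

  tail∈innerˡ : {e : Edge} (X Y : Biset n) → CoversEdge e (X ∩ᵇ Y) → tail e ∈ inner X
  tail∈innerˡ X Y (t∈X∩Y , _) = proj₁ (x∈p∩q⁻ (inner X) (inner Y) t∈X∩Y)

  intersect-sym : (X Y : Biset n) → Intersect X Y → Intersect Y X
  intersect-sym X Y (v , v∈X∩Y) with x∈p∩q⁻ (inner X) (inner Y) v∈X∩Y
  ... | v∈X , v∈Y = v , x∈p∩q⁺ (v∈Y , v∈X)

  covers-∩ᵇ : {e : Edge} (X Y : Biset n) →
    CoversEdge e (X ∩ᵇ Y) → CoversEdge e X ⊎ CoversEdge e Y
  covers-∩ᵇ {e} X Y (t∈X∩Y , h∉X⁺∩Y⁺) with x∈p∩q⁻ (inner X) (inner Y) t∈X∩Y | head e ∈? outer X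
  ... | t∈X , t∈Y | yes h∈X⁺ = inj₂ (t∈Y , λ h∈Y⁺ → h∉X⁺∩Y⁺ (x∈p∩q⁺ (h∈X⁺ , h∈Y⁺)))
  ... | t∈X , t∈Y | no h∉X⁺ = inj₁ (t∈X , h∉X⁺)

  module _ {J : EdgeSet {n}} {C : Biset n} (C-uncovered : ¬ ∃ (δ J C)) where

    uncovered⇒head∈outer : ∀ {e} → J e → tail e ∈ inner C → head e ∈ outer C
    uncovered⇒head∈outer {e} Je t∈C =
      decidable-stable (head e ∈? outer C) λ h∉C⁺ → C-uncovered (e , Je , t∈C , h∉C⁺)

    covers-∩ᵇ-uncoveredʳ : ∀ {e} (U : Biset n) → J e → CoversEdge e (C ∩ᵇ U) → CoversEdge e U
    covers-∩ᵇ-uncoveredʳ {e} U Je cov with covers-∩ᵇ C U cov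
    ... | inj₁ covC = contradiction (e , Je , covC) C-uncovered
    ... | inj₂ covU = covU

  module _ {𝒮 : Family {n}} {J : EdgeSet {n}} (∩-closed : IntersectionClosed 𝒮) where

    uncovered-∩ᵇ : (X Y : Biset n) → uncovered 𝒮 J X → uncovered 𝒮 J Y → Intersect X Y →
      uncovered 𝒮 J (X ∩ᵇ Y)
    uncovered-∩ᵇ X Y (X∈𝒮 , X-uncovered) (Y∈𝒮 , Y-uncovered) X∩Y≠∅ =
      ∩-closed X Y X∈𝒮 Y∈𝒮 X∩Y≠∅ , λ where
        (e , Je , cov) → [ (λ covX → X-uncovered (e , Je , covX))
                         , (λ covY → Y-uncovered (e , Je , covY)) ] (covers-∩ᵇ X Y cov)

    intersecting-cores-≡ : {C C′ : Biset n} →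
      IsCore (uncovered 𝒮 J) C → IsCore (uncovered 𝒮 J) C′ → Intersect C C′ → C′ ≡ C
    intersecting-cores-≡ {C} {C′} (C-unc , C-min) (C′-unc , C′-min) C∩C′≠∅ =
      trans (sym (C′-min (C ∩ᵇ C′) meet-unc (∩ᵇ-⊆ᵇʳ C C′)))
            (C-min (C ∩ᵇ C′) meet-unc (∩ᵇ-⊆ᵇˡ C C′))
      where
      meet-unc : uncovered 𝒮 J (C ∩ᵇ C′)
      meet-unc = uncovered-∩ᵇ C C′ C-unc C′-unc C∩C′≠∅

    module UniqueEdge {𝒰 : Family {n}} {F : EdgeSet {n}}
             (𝒰⊆𝒮 : ∀ U → 𝒰 U → 𝒮 U) (J⊆F : J ⊆ᵉ F)
             (J-covers : CoversFamily J (restrictTo 𝒮 𝒰)) where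

      unique-edge-covers-∩ᵇ : {C U : Biset n} {eU : Edge} → uncovered 𝒮 J C → 𝒰 U →
        Intersect C U → δIsSingleton F U eU → δ J (C ∩ᵇ U) eU
      unique-edge-covers-∩ᵇ {C} {U} (C∈𝒮 , C-uncovered) U∈𝒰 C∩U≠∅ single
        with J-covers (C ∩ᵇ U) (∩-closed C U C∈𝒮 (𝒰⊆𝒮 U U∈𝒰) C∩U≠∅ , U , U∈𝒰 , ∩ᵇ-⊆ᵇʳ C U)
      ... | e , Je , cov
        with Equivalence.to (single e) (J⊆F e Je , covers-∩ᵇ-uncoveredʳ C-uncovered U Je cov)
      ... | refl = Je , cov

      unique-edge-head∈outer : {C U : Biset n} {eU : Edge} → uncovered 𝒮 J C → 𝒰 U →
        Intersect C U → δIsSingleton F U eU → head eU ∈ outer C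
      unique-edge-head∈outer {C} {U} C-unc@(_ , C-uncovered) U∈𝒰 C∩U≠∅ single
        with unique-edge-covers-∩ᵇ C-unc U∈𝒰 C∩U≠∅ single
      ... | JeU , cov = uncovered⇒head∈outer C-uncovered JeU (tail∈innerˡ C U cov)

      δ-∩ᵇ-singleton : {C U : Biset n} {eU : Edge} → uncovered 𝒮 J C → 𝒰 U →
        Intersect C U → δIsSingleton F U eU → δIsSingleton J (C ∩ᵇ U) eU
      δ-∩ᵇ-singleton {U = U} C-unc@(_ , C-uncovered) U∈𝒰 C∩U≠∅ single e = mk⇔
        (λ (Je , cov) →
           Equivalence.to (single e) (J⊆F e Je , covers-∩ᵇ-uncoveredʳ C-uncovered U Je cov))
        (λ { refl → unique-edge-covers-∩ᵇ C-unc U∈𝒰 C∩U≠∅ single })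

      cores-met-by-member-≡ : {C C′ U : Biset n} {eU : Edge} →
        IsCore (uncovered 𝒮 J) C → IsCore (uncovered 𝒮 J) C′ → 𝒰 U → δIsSingleton F U eU →
        Intersect U C → Intersect U C′ → C′ ≡ C
      cores-met-by-member-≡ {C} {C′} {U} {eU}
        C-core@(C-unc , _) C′-core@(C′-unc , _) U∈𝒰 single U∩C≠∅ U∩C′≠∅ =
        intersecting-cores-≡ C-core C′-core
          (tail eU , x∈p∩q⁺ (tail∈innerˡ C U (proj₂ (crosses C-unc U∩C≠∅)) ,
                             tail∈innerˡ C′ U (proj₂ (crosses C′-unc U∩C′≠∅))))
        where
        crosses : ∀ {D} → uncovered 𝒮 J D → Intersect U D → δ J (D ∩ᵇ U) eU
        crosses {D} D-unc U∩D≠∅ = unique-edge-covers-∩ᵇ D-unc U∈𝒰 (intersect-sym U D U∩D≠∅) single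

      module _ (F-tails : ∀ e → F e → ∃ λ U → 𝒰 U × tail e ∈ inner U)
               (unique-edge : ∀ U → 𝒰 U → ∃ λ e → δIsSingleton F U e)
               {C B : Biset n} (C-unc : uncovered 𝒮 J C) (B-union : IsUnionWithIntersecting 𝒰 C B)
               where

        tail-in-member-meeting : ∀ {e} → F e → tail e ∈ inner B →
          ∃ λ U → 𝒰 U × Intersect U C × tail e ∈ inner U
        tail-in-member-meeting {e} Fe t∈B with Equivalence.to (proj₁ B-union (tail e)) t∈B
        ... | inj₂ U-meeting-C = U-meeting-C
        ... | inj₁ t∈C with F-tails e Fe
        ... | U , U∈𝒰 , t∈U = U , U∈𝒰 , (tail e , x∈p∩q⁺ (t∈U , t∈C)) , t∈U

        outer⊆union-outer : outer C ⊆ outer B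
        outer⊆union-outer {v} v∈C⁺ = Equivalence.from (proj₂ B-union v) (inj₁ v∈C⁺)

        member-outer⊆union-outer : ∀ {U} → 𝒰 U → Intersect U C → outer U ⊆ outer B
        member-outer⊆union-outer {U} U∈𝒰 U∩C≠∅ {v} v∈U⁺ =
          Equivalence.from (proj₂ B-union v) (inj₂ (U , U∈𝒰 , U∩C≠∅ , v∈U⁺))

        union-δ-empty : δIsEmpty F B
        union-δ-empty e (Fe , t∈B , h∉B⁺) with tail-in-member-meeting Fe t∈B
        ... | U , U∈𝒰 , U∩C≠∅ , t∈U with unique-edge U U∈𝒰
        ... | eU , single
          with Equivalence.to (single e)
                 (Fe , t∈U , λ h∈U⁺ → h∉B⁺ (member-outer⊆union-outer U∈𝒰 U∩C≠∅ h∈U⁺))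
        ... | refl = h∉B⁺ (outer⊆union-outer
                             (unique-edge-head∈outer C-unc U∈𝒰 (intersect-sym U C U∩C≠∅) single))

lemma9 : {n : ℕ} (𝒮 𝒰 : Family {n}) (F J : EdgeSet {n}) →
    IsBisetFamily 𝒮 →
    IntersectionClosed 𝒮 →
    CoversFamily F 𝒮 →
    (∀ U → 𝒰 U → 𝒮 U) →
    (∀ X Y → 𝒰 X → 𝒰 Y → X ≢ Y → Disjoint X Y) →
    (∀ e → F e → ∃ λ U → 𝒰 U × tail e ∈ inner U) →
    (∀ U → 𝒰 U → ∃ λ e → δIsSingleton F U e) →
    J ⊆ᵉ F →
    CoversFamily J (restrictTo 𝒮 𝒰) →
    (C : Biset n) → IsCore (uncovered 𝒮 J) C →
    ((∀ U eU → 𝒰 U → Intersect C U → δIsSingleton F U eU →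
        δIsSingleton J (C ∩ᵇ U) eU)
     × (∀ U C' → 𝒰 U → Intersect U C → IsCore (uncovered 𝒮 J) C' → C' ≢ C →
        ¬ Intersect U C'))
    × (∀ B → IsUnionWithIntersecting 𝒰 C B → δIsEmpty F B × ¬ 𝒮 B)
lemma9 𝒮 𝒰 F J _ ∩-closed F-covers 𝒰⊆𝒮 _ F-tails unique-edge J⊆F J-covers C C-core@(C-unc , _) =
  ( (λ U eU U∈𝒰 C∩U≠∅ → δ-∩ᵇ-singleton C-unc U∈𝒰 C∩U≠∅)
  , (λ U C′ U∈𝒰 U∩C≠∅ C′-core C′≢C U∩C′≠∅ →
       let (eU , single) = unique-edge U U∈𝒰
       in C′≢C (cores-met-by-member-≡ C-core C′-core U∈𝒰 single U∩C≠∅ U∩C′≠∅)) )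
  , λ B B-union →
      let no-edge = union-δ-empty F-tails unique-edge C-unc B-union
      in no-edge , λ B∈𝒮 → let (e , δe) = F-covers B B∈𝒮 in no-edge e δe
  where
  open UniqueEdge ∩-closed 𝒰⊆𝒮 J⊆F J-covers
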